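{- Let $\Delta\ge 0$ and $q\ge 2$ be integers. There exists a rooted, partially edge-colored tree $T=T(\Delta,q)$ with the following properties: (a) for every leaf $v$ of $T$ there is a color $c_v$ such that $v$ is the unique leaf of minimal depth among those leaves that remain connected to the root in $T-c_v$; (b) each color appears on at most $\Delta$ edges of $T$; (c) $T$ has $q^\Delta$ leaves; (d) each leaf of $T$ has depth at least $q^\Delta-1$ and at most $2(q^\Delta-1)$; (e) $T$ has exactly $\Delta(q^{\Delta+1}-q^{\Delta-1})$ edges.
   Context: A partially edge-colored tree is one in which each edge either has exactly one color or no color. $T-c$ denotes $T$ with all edges of color $c$ deleted. The depth of a vertex is its (unweighted) distance from the root. -}

module Defs where

open import Data.Nat using (ℕ; zero; suc; _≟_; _+_; _*_; _∸_; _^_; _≤_; _<_)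
open import Data.List using (List; []; _∷_)
open import Data.Maybe using (Maybe; just; nothing)
open import Data.Product using (_×_; _,_; proj₁; proj₂)
open import Data.List.Membership.Propositional using (_∈_)
open import Data.List.Relation.Unary.All using (All)
open import Relation.Nullary using (yes; no)
open import Relation.Binary.PropositionalEquality using (_≡_; _≢_)

Color : Set
Color = ℕ

-- A rooted, partially edge-coloured tree: a root together with the list of
-- its child edges; each edge carries either one colour (just c) or none
-- (nothing), and leads to the subtree hanging below it.
data Tree : Set where
  node : List (Maybe Color × Tree) → Tree

data Vertex : Tree → Set where
  root  : ∀ {cs} → Vertex (node cs)
  below : ∀ {cs} {e : Maybe Color × Tree} →
          e ∈ cs → Vertex (proj₂ e) → Vertex (node cs)

subtreeAt : ∀ {t} → Vertex t → Tree
subtreeAt {t} root = t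
subtreeAt (below _ v) = subtreeAt v

IsLeaf : ∀ {t} → Vertex t → Set
IsLeaf v = subtreeAt v ≡ node []

depth : ∀ {t} → Vertex t → ℕ
depth root = 0
depth (below _ v) = suc (depth v)

pathLabels : ∀ {t} → Vertex t → List (Maybe Color)
pathLabels root = []
pathLabels (below {e = e} _ v) = proj₁ e ∷ pathLabels v

-- v is still connected to the root in T - c  (no edge of colour c on its
-- root path; in a tree this path is unique).
ConnectedAvoiding : ∀ {t} → Color → Vertex t → Set
ConnectedAvoiding c v = All (λ m → m ≢ just c) (pathLabels v)

countEq : Color → Maybe Color → ℕ
countEq c nothing = 0
countEq c (just d) with c ≟ d
... | yes _ = 1
... | no _ = 0

mutual
  colorCount : Color → Tree → ℕ
  colorCount c (node cs) = colorCountL c cs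

  colorCountL : Color → List (Maybe Color × Tree) → ℕ
  colorCountL c [] = 0
  colorCountL c ((m , s) ∷ cs) = countEq c m + colorCount c s + colorCountL c cs

mutual
  edgeCount : Tree → ℕ
  edgeCount (node cs) = edgeCountL cs

  edgeCountL : List (Maybe Color × Tree) → ℕ
  edgeCountL [] = 0
  edgeCountL ((_ , s) ∷ cs) = suc (edgeCount s + edgeCountL cs)

mutual
  leafCount : Tree → ℕ
  leafCount (node []) = 1
  leafCount (node (e ∷ cs)) = leafCountL (e ∷ cs)

  leafCountL : List (Maybe Color × Tree) → ℕ
  leafCountL [] = 0
  leafCountL ((_ , s) ∷ cs) = leafCount s + leafCountL cs

-- T(d) is built from q copies of T(d-1) with pairwise disjoint color blocks,
-- added one at a time: a new root gets two branches, the tree built so far below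
-- a path colored with the whole block of the next copy, and the next copy below
-- an uncolored path long enough that its leaves lie deeper than all earlier
-- ones. A leaf keeps the color isolating it inside its copy: that color cuts off
-- every earlier copy through the path above them, and every later copy is
-- deeper. Each color lies on at most one such path, so multiplicities grow by
-- one per level; depths and edge counts follow by tracking the path lengths.
module Submission where

open import Defs
open import Data.Nat using (ℕ; zero; suc; _+_; _*_; _∸_; _^_; _≤_; _<_; z≤n; s≤s; z<s; _≟_; _<?_)
open import Data.Nat.Properties
open import Data.Nat.Tactic.RingSolver using (solve-∀)
open import Data.Product using (Σ; _×_; _,_; proj₁; proj₂; map₂)
open import Data.Sum using (inj₁; inj₂)
open import Data.Maybe using (Maybe; just; nothing)
open import Data.List using (List; []; _∷_; _++_; length; replicate; map)
open import Data.Nat.ListAction using (sum)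
open import Data.List.Properties using (length-replicate)
open import Data.List.Membership.Propositional using (_∈_)
open import Data.List.Relation.Unary.All as All using (All; []; _∷_)
open import Data.List.Relation.Unary.All.Properties using (replicate⁺)
open import Data.List.Relation.Unary.Any using (here; there)
open import Data.Empty using (⊥-elim)
open import Function using (_∘_)
open import Level using (0ℓ)
open import Relation.Nullary using (¬_; yes; no)
open import Relation.Unary using (Pred; _∪_; _⊆_)
open import Relation.Binary.PropositionalEquality
  using (_≡_; _≢_; refl; sym; trans; cong; cong₂; subst; module ≡-Reasoning)

private variable
  t u : Tree
  l l′ : Maybe Color
  ls : List (Maybe Color)
  c : Color
  lo mid hi lo′ hi′ : ℕ
  P Q : Pred Color 0ℓ

plant : Maybe Color → Tree → Tree
plant l t = node ((l , t) ∷ [])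

chain : List (Maybe Color) → Tree → Tree
chain []       t = t
chain (l ∷ ls) t = plant l (chain ls t)

joinRoots : Tree → Tree → Tree
joinRoots (node es) (node fs) = node (es ++ fs)

Interval : Color → Color → Pred Color 0ℓ
Interval lo hi c = lo ≤ c × c < hi

Interval-⊆ : lo′ ≤ lo → hi ≤ hi′ → Interval lo hi ⊆ Interval lo′ hi′
Interval-⊆ lo′≤lo hi≤hi′ (lo≤c , c<hi) = ≤-trans lo′≤lo lo≤c , <-≤-trans c<hi hi≤hi′

Interval-∪ : lo ≤ mid → mid ≤ hi → (Interval lo mid ∪ Interval mid hi) ⊆ Interval lo hi
Interval-∪ lo≤mid mid≤hi (inj₁ c∈) = Interval-⊆ ≤-refl mid≤hi c∈
Interval-∪ lo≤mid mid≤hi (inj₂ c∈) = Interval-⊆ lo≤mid ≤-refl c∈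

LeafDepthsIn : Tree → ℕ → ℕ → Set
LeafDepthsIn t lo hi = (v : Vertex t) → IsLeaf v → lo ≤ depth v × depth v ≤ hi

Shallower : Tree → Tree → Set
Shallower t u = (v : Vertex t) (w : Vertex u) → IsLeaf v → IsLeaf w → depth v < depth w

depths-mono : lo′ ≤ lo → hi ≤ hi′ → LeafDepthsIn t lo hi → LeafDepthsIn t lo′ hi′
depths-mono lo′≤lo hi≤hi′ ds v leaf =
  ≤-trans lo′≤lo (proj₁ (ds v leaf)) , ≤-trans (proj₂ (ds v leaf)) hi≤hi′

depths-shallower : LeafDepthsIn t lo hi → LeafDepthsIn u lo′ hi′ → hi < lo′ → Shallower t u
depths-shallower dt du hi<lo′ v w leafv leafw =
  ≤-<-trans (proj₂ (dt v leafv)) (<-≤-trans hi<lo′ (proj₁ (du w leafw)))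

plant-depths : LeafDepthsIn t lo hi → LeafDepthsIn (plant l t) (suc lo) (suc hi)
plant-depths ds root ()
plant-depths ds (below (here refl) v) leaf = s≤s (proj₁ (ds v leaf)) , s≤s (proj₂ (ds v leaf))
plant-depths ds (below (there ()) _) _

chain-depths : ∀ ls → LeafDepthsIn t lo hi → LeafDepthsIn (chain ls t) (length ls + lo) (length ls + hi)
chain-depths []       ds = ds
chain-depths (l ∷ ls) ds = plant-depths (chain-depths ls ds)

joinRoots-depths : LeafDepthsIn (plant l t) lo hi → LeafDepthsIn (plant l′ u) lo hi →
                   LeafDepthsIn (joinRoots (plant l t) (plant l′ u)) lo hi
joinRoots-depths dt du root ()
joinRoots-depths dt du (below (here refl) v)         = dt (below (here refl) v)
joinRoots-depths dt du (below (there (here refl)) v) = du (below (here refl) v)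
joinRoots-depths dt du (below (there (there ())) _)

Isolates : ∀ {t} → Color → Vertex t → Set
Isolates {t} c v = ConnectedAvoiding c v ×
  ((w : Vertex t) → IsLeaf w → ConnectedAvoiding c w → w ≢ v → depth v < depth w)

LeavesIsolatedBy : Pred Color 0ℓ → Tree → Set
LeavesIsolatedBy P t = (v : Vertex t) → IsLeaf v → Σ Color (λ c → P c × Isolates c v)

Blocks : Color → Tree → Set
Blocks c t = (w : Vertex t) → IsLeaf w → ¬ ConnectedAvoiding c w

Avoids : Pred Color 0ℓ → Maybe Color → Set
Avoids P l = ∀ {c} → P c → l ≢ just c

avoids-mono : P ⊆ Q → Avoids Q ⊆ Avoids P
avoids-mono P⊆Q avoid Pc = avoid (P⊆Q Pc)

isolated-mono : P ⊆ Q → LeavesIsolatedBy P t → LeavesIsolatedBy Q t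
isolated-mono P⊆Q iso v leaf with iso v leaf
... | c , Pc , isolates = c , P⊆Q Pc , isolates

plant-isolated : Avoids P l → LeavesIsolatedBy P t → LeavesIsolatedBy P (plant l t)
plant-isolated avoid iso root ()
plant-isolated {l = l} {t = t} avoid iso (below (here refl) v) leaf with iso v leaf
... | c , Pc , connected , deeper = c , Pc , avoid Pc ∷ connected , deeper′
  where
  deeper′ : (w : Vertex (plant l t)) → IsLeaf w → ConnectedAvoiding c w →
            w ≢ below (here refl) v → suc (depth v) < depth w
  deeper′ root () _ _
  deeper′ (below (here refl) w) leafw (_ ∷ connectedw) w≢v =
    s≤s (deeper w leafw connectedw (w≢v ∘ cong (below (here refl))))
  deeper′ (below (there ()) _) _ _ _
plant-isolated _ _ (below (there ()) _) _

chain-isolated : All (Avoids P) ls → LeavesIsolatedBy P t → LeavesIsolatedBy P (chain ls t)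
chain-isolated []               iso = iso
chain-isolated (avoid ∷ avoids) iso = plant-isolated avoid (chain-isolated avoids iso)

chain-blocks : just c ∈ ls → Blocks c (chain ls t)
chain-blocks (here refl)  root ()
chain-blocks (here refl)  (below (here refl) _) _ (l≢c ∷ _) = l≢c refl
chain-blocks (there c∈ls) root ()
chain-blocks (there c∈ls) (below (here refl) w) leaf (_ ∷ connected) = chain-blocks c∈ls w leaf connected
chain-blocks (here refl)  (below (there ()) _) _ _
chain-blocks (there _)    (below (there ()) _) _ _

module _ {l l′ : Maybe Color} {t u : Tree} where

  private
    J : Tree
    J = joinRoots (plant l t) (plant l′ u)

    intoLeft : Vertex (plant l t) → Vertex J
    intoLeft root                  = root
    intoLeft (below (here refl) v) = below (here refl) v
    intoLeft (below (there ()) _)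

    intoRight : Vertex (plant l′ u) → Vertex J
    intoRight root                  = root
    intoRight (below (here refl) v) = below (there (here refl)) v
    intoRight (below (there ()) _)

  -- A right leaf keeps its own isolating color, which cuts off the whole left
  -- side; a left leaf keeps its color because every right leaf is deeper.
  joinRoots-isolated : LeavesIsolatedBy P (plant l t) → LeavesIsolatedBy Q (plant l′ u) →
                       Shallower (plant l t) (plant l′ u) → (∀ {c} → Q c → Blocks c (plant l t)) →
                       LeavesIsolatedBy (P ∪ Q) (joinRoots (plant l t) (plant l′ u))
  joinRoots-isolated isoL isoR shallower blocks root ()
  joinRoots-isolated isoL isoR shallower blocks (below (here refl) v) leaf
    with isoL (below (here refl) v) leaf
  ... | c , Pc , connected , deeper = c , inj₁ Pc , connected , deeper′
    where
    deeper′ : (w : Vertex J) → IsLeaf w → ConnectedAvoiding c w →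
              w ≢ below (here refl) v → suc (depth v) < depth w
    deeper′ root () _ _
    deeper′ (below (here refl) w) leafw connectedw w≢v =
      deeper (below (here refl) w) leafw connectedw (w≢v ∘ cong intoLeft)
    deeper′ (below (there (here refl)) w) leafw _ _ =
      shallower (below (here refl) v) (below (here refl) w) leaf leafw
    deeper′ (below (there (there ())) _) _ _ _
  joinRoots-isolated isoL isoR shallower blocks (below (there (here refl)) v) leaf
    with isoR (below (here refl) v) leaf
  ... | c , Qc , connected , deeper = c , inj₂ Qc , connected , deeper′
    where
    deeper′ : (w : Vertex J) → IsLeaf w → ConnectedAvoiding c w →
              w ≢ below (there (here refl)) v → suc (depth v) < depth w
    deeper′ root () _ _
    deeper′ (below (here refl) w) leafw connectedw _ =
      ⊥-elim (blocks Qc (below (here refl) w) leafw connectedw)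
    deeper′ (below (there (here refl)) w) leafw connectedw w≢v =
      deeper (below (here refl) w) leafw connectedw (w≢v ∘ cong intoRight)
    deeper′ (below (there (there ())) _) _ _ _
  joinRoots-isolated _ _ _ _ (below (there (there ())) _) _

leafCountL-++ : ∀ es fs → leafCountL (es ++ fs) ≡ leafCountL es + leafCountL fs
leafCountL-++ []             fs = refl
leafCountL-++ ((_ , s) ∷ es) fs =
  trans (cong (leafCount s +_) (leafCountL-++ es fs)) (sym (+-assoc (leafCount s) _ _))

edgeCountL-++ : ∀ es fs → edgeCountL (es ++ fs) ≡ edgeCountL es + edgeCountL fs
edgeCountL-++ []             fs = refl
edgeCountL-++ ((_ , s) ∷ es) fs =
  cong suc (trans (cong (edgeCount s +_) (edgeCountL-++ es fs)) (sym (+-assoc (edgeCount s) _ _)))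

colorCountL-++ : ∀ c es fs → colorCountL c (es ++ fs) ≡ colorCountL c es + colorCountL c fs
colorCountL-++ c []             fs = refl
colorCountL-++ c ((l , s) ∷ es) fs =
  trans (cong (countEq c l + colorCount c s +_) (colorCountL-++ c es fs))
        (sym (+-assoc (countEq c l + colorCount c s) _ _))

-- A single vertex is a leaf, but contributes no leaf once glued to another root.
joinRoots-leafCount : ∀ t u → t ≢ node [] → u ≢ node [] →
                      leafCount (joinRoots t u) ≡ leafCount t + leafCount u
joinRoots-leafCount (node [])      _              t≢• _   = ⊥-elim (t≢• refl)
joinRoots-leafCount (node (_ ∷ _)) (node [])      _   u≢• = ⊥-elim (u≢• refl)
joinRoots-leafCount (node (e ∷ es)) (node (f ∷ fs)) _ _   = leafCountL-++ (e ∷ es) (f ∷ fs)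

joinRoots-edgeCount : ∀ t u → edgeCount (joinRoots t u) ≡ edgeCount t + edgeCount u
joinRoots-edgeCount (node es) (node fs) = edgeCountL-++ es fs

joinRoots-colorCount : ∀ c t u → colorCount c (joinRoots t u) ≡ colorCount c t + colorCount c u
joinRoots-colorCount c (node es) (node fs) = colorCountL-++ c es fs

labelCount : Color → List (Maybe Color) → ℕ
labelCount c ls = sum (map (countEq c) ls)

countEq-≢ : ∀ {c d} → c ≢ d → countEq c (just d) ≡ 0
countEq-≢ {c} {d} c≢d with c ≟ d
... | yes c≡d = ⊥-elim (c≢d c≡d)
... | no  _   = refl

labelCount-replicate : ∀ c n → labelCount c (replicate n nothing) ≡ 0
labelCount-replicate c zero    = refl
labelCount-replicate c (suc n) = labelCount-replicate c n

chain-leafCount : ∀ ls → leafCount (chain ls t) ≡ leafCount t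
chain-leafCount []       = refl
chain-leafCount (l ∷ ls) = trans (+-identityʳ _) (chain-leafCount ls)

chain-edgeCount : ∀ ls → edgeCount (chain ls t) ≡ length ls + edgeCount t
chain-edgeCount []       = refl
chain-edgeCount (l ∷ ls) = cong suc (trans (+-identityʳ _) (chain-edgeCount ls))

chain-colorCount : ∀ c ls → colorCount c (chain ls t) ≡ labelCount c ls + colorCount c t
chain-colorCount c []                 = refl
chain-colorCount {t = t} c (l ∷ ls) = begin
  countEq c l + colorCount c (chain ls t) + 0   ≡⟨ +-identityʳ _ ⟩
  countEq c l + colorCount c (chain ls t)       ≡⟨ cong (countEq c l +_) (chain-colorCount c ls) ⟩
  countEq c l + (labelCount c ls + colorCount c t) ≡⟨ +-assoc (countEq c l) _ _ ⟨
  countEq c l + labelCount c ls + colorCount c t ∎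
  where open ≡-Reasoning

colorRun : Color → ℕ → List (Maybe Color)
colorRun a zero    = []
colorRun a (suc n) = just a ∷ colorRun (suc a) n

length-colorRun : ∀ a n → length (colorRun a n) ≡ n
length-colorRun a zero    = refl
length-colorRun a (suc n) = cong suc (length-colorRun (suc a) n)

colorRun-avoids : ∀ a n → All (Avoids (_< a)) (colorRun a n)
colorRun-avoids a zero    = []
colorRun-avoids a (suc n) =
  (λ { c<a refl → <-irrefl refl c<a }) ∷
  All.map (λ avoid {c} c<a → avoid (m<n⇒m<1+n c<a)) (colorRun-avoids (suc a) n)

colorRun-∈ : ∀ a n → Interval a (a + n) c → just c ∈ colorRun a n
colorRun-∈ {c} a zero    (a≤c , c<a+0) = ⊥-elim (<⇒≱ (subst (c <_) (+-identityʳ a) c<a+0) a≤c)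
colorRun-∈ {c} a (suc n) (a≤c , c<a+1+n) with a ≟ c
... | yes refl = here refl
... | no  a≢c  = there (colorRun-∈ (suc a) n (≤∧≢⇒< a≤c a≢c , subst (c <_) (+-suc a n) c<a+1+n))

labelCount-colorRun-outside : ∀ a n → ¬ Interval a (a + n) c → labelCount c (colorRun a n) ≡ 0
labelCount-colorRun-outside a zero    _ = refl
labelCount-colorRun-outside {c} a (suc n) c∉ = cong₂ _+_ (countEq-≢ c≢a) (labelCount-colorRun-outside (suc a) n c∉′)
  where
  c≢a : c ≢ a
  c≢a refl = c∉ (≤-refl , m<m+n c z<s)
  c∉′ : ¬ Interval (suc a) (suc a + n) c
  c∉′ (a<c , c<end) = c∉ (<⇒≤ a<c , subst (c <_) (sym (+-suc a n)) c<end)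

labelCount-colorRun-≤1 : ∀ c a n → labelCount c (colorRun a n) ≤ 1
labelCount-colorRun-≤1 c a zero = z≤n
labelCount-colorRun-≤1 c a (suc n) with c ≟ a
... | yes refl = ≤-reflexive (cong suc (labelCount-colorRun-outside (suc c) n λ (c<c , _) → <-irrefl refl c<c))
... | no  _    = labelCount-colorRun-≤1 c (suc a) n

-- The index B is the first color of the block [B, B + suc m) available to the
-- tree, so that copies with disjoint color blocks can be combined.
record IsolatingFamily (m colors edges : ℕ) (tree : Color → Tree) : Set where
  field
    depths     : ∀ B → LeafDepthsIn (tree B) m (2 * m)
    isolated   : ∀ B → LeavesIsolatedBy (Interval B (B + suc m)) (tree B)
    unused     : ∀ B {c} → ¬ Interval B (B + suc m) c → colorCount c (tree B) ≡ 0
    colorBound : ∀ B c → colorCount c (tree B) ≤ colors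
    leafTotal  : ∀ B → leafCount (tree B) ≡ suc m
    edgeTotal  : ∀ B → edgeCount (tree B) ≡ edges

single-vertex-family : IsolatingFamily 0 0 0 (λ _ → node [])
single-vertex-family = record
  { depths     = depths
  ; isolated   = isolated
  ; unused     = λ _ _ → refl
  ; colorBound = λ _ _ → z≤n
  ; leafTotal  = λ _ → refl
  ; edgeTotal  = λ _ → refl
  }
  where
  depths : ∀ B → LeafDepthsIn (node []) 0 0
  depths B root _ = z≤n , z≤n
  depths B (below () _) _

  isolated : ∀ B → LeavesIsolatedBy (Interval B (B + 1)) (node [])
  isolated B root _ = B , (≤-refl , m<m+n B z<s) , [] , onlyLeaf
    where
    onlyLeaf : (w : Vertex (node [])) → IsLeaf w → ConnectedAvoiding B w → w ≢ root → 0 < depth w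
    onlyLeaf root _ _ root≢root = ⊥-elim (root≢root refl)
    onlyLeaf (below () _) _ _ _
  isolated B (below () _) _

module Comb (m : ℕ) (copy : Color → Tree) where

  offset : Color → ℕ → Color
  offset B k = B + k * suc m

  offset-suc : ∀ B k → offset B k + suc m ≡ offset B (suc k)
  offset-suc B k = trans (+-assoc B (k * suc m) (suc m)) (cong (B +_) (+-comm (k * suc m) (suc m)))

  rightBranch : Color → ℕ → Tree
  rightBranch B k = chain (replicate (2 * (suc k * suc m)) nothing) (copy (offset B (suc k)))

  -- Copy k+1 uses the color block starting at offset B (suc k). That block is
  -- laid out on the path above comb B k, so each of its colors cuts off all
  -- earlier copies, while copy k+1 hangs below an uncolored path whose length is
  -- chosen so that its shallowest leaf lies exactly one level below the deepest
  -- leaf of comb B k.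
  mutual
    comb : Color → ℕ → Tree
    comb B zero    = copy B
    comb B (suc k) = joinRoots (leftBranch B k) (rightBranch B k)

    leftBranch : Color → ℕ → Tree
    leftBranch B k = chain (colorRun (offset B (suc k)) (suc m)) (comb B k)

  leftBranch-depths : ∀ B k → LeafDepthsIn (comb B k) lo hi →
                      LeafDepthsIn (leftBranch B k) (suc m + lo) (suc m + hi)
  leftBranch-depths {lo} {hi} B k ds =
    subst (λ n → LeafDepthsIn (leftBranch B k) (n + lo) (n + hi))
          (length-colorRun (offset B (suc k)) (suc m))
          (chain-depths (colorRun (offset B (suc k)) (suc m)) ds)

  comb-colorCount : ∀ B k c →
    colorCount c (comb B (suc k)) ≡
    labelCount c (colorRun (offset B (suc k)) (suc m)) + colorCount c (comb B k) + colorCount c (copy (offset B (suc k)))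
  comb-colorCount B k c = begin
    colorCount c (comb B (suc k))
      ≡⟨ joinRoots-colorCount c (leftBranch B k) (rightBranch B k) ⟩
    colorCount c (leftBranch B k) + colorCount c (rightBranch B k)
      ≡⟨ cong₂ _+_ (chain-colorCount c (colorRun a (suc m))) (chain-colorCount c (replicate r nothing)) ⟩
    labelCount c (colorRun a (suc m)) + colorCount c (comb B k) + (labelCount c (replicate r nothing) + colorCount c (copy a))
      ≡⟨ cong (λ n → labelCount c (colorRun a (suc m)) + colorCount c (comb B k) + (n + colorCount c (copy a)))
              (labelCount-replicate c r) ⟩
    labelCount c (colorRun a (suc m)) + colorCount c (comb B k) + colorCount c (copy a) ∎
    where
    open ≡-Reasoning
    a r : ℕ
    a = offset B (suc k)
    r = 2 * (suc k * suc m)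

  module _ {colors edges : ℕ} (F : IsolatingFamily m colors edges copy) where
    open IsolatingFamily F

    rightBranch-depths : ∀ B k → LeafDepthsIn (rightBranch B k) (2 * (suc k * suc m) + m) (2 * (suc k * suc m) + 2 * m)
    rightBranch-depths B k =
      subst (λ n → LeafDepthsIn (rightBranch B k) (n + m) (n + 2 * m))
            (length-replicate (2 * (suc k * suc m)))
            (chain-depths (replicate (2 * (suc k * suc m)) nothing) (depths (offset B (suc k))))

    comb-depths : ∀ B k → LeafDepthsIn (comb B k) (m + k * suc m) (2 * (m + k * suc m))
    comb-depths B zero    = subst (λ n → LeafDepthsIn (copy B) n (2 * n)) (sym (+-identityʳ m)) (depths B)
    comb-depths B (suc k) = joinRoots-depths
      (depths-mono (≤-reflexive (leftLower m k)) (≤-trans (m≤m+n _ (suc m)) (≤-reflexive (leftUpper m k)))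
                   (leftBranch-depths B k (comb-depths B k)))
      (depths-mono (≤-trans (m≤m+n _ (suc k * suc m)) (≤-reflexive (rightLower m k))) (≤-reflexive (rightUpper m k))
                   (rightBranch-depths B k))
      where
      leftLower : ∀ m k → m + suc k * suc m ≡ suc m + (m + k * suc m)
      leftLower = solve-∀
      leftUpper : ∀ m k → suc m + 2 * (m + k * suc m) + suc m ≡ 2 * (m + suc k * suc m)
      leftUpper = solve-∀
      rightLower : ∀ m k → m + suc k * suc m + suc k * suc m ≡ 2 * (suc k * suc m) + m
      rightLower = solve-∀
      rightUpper : ∀ m k → 2 * (suc k * suc m) + 2 * m ≡ 2 * (m + suc k * suc m)
      rightUpper = solve-∀

    branches-shallower : ∀ B k → Shallower (leftBranch B k) (rightBranch B k)
    branches-shallower B k =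
      depths-shallower (leftBranch-depths B k (comb-depths B k)) (rightBranch-depths B k) (≤-reflexive (gap m k))
      where
      gap : ∀ m k → suc (suc m + 2 * (m + k * suc m)) ≡ 2 * (suc k * suc m) + m
      gap = solve-∀

    comb-isolated : ∀ B k → LeavesIsolatedBy (Interval B (offset B (suc k))) (comb B k)
    comb-isolated B zero    = isolated-mono (Interval-⊆ ≤-refl (+-monoʳ-≤ B (m≤m+n (suc m) 0))) (isolated B)
    comb-isolated B (suc k) =
      isolated-mono (λ c∈ → Interval-⊆ ≤-refl (≤-reflexive (offset-suc B (suc k)))
                              (Interval-∪ (m≤m+n B _) (m≤m+n a (suc m)) c∈))
        (joinRoots-isolated left right (branches-shallower B k) (chain-blocks ∘ colorRun-∈ a (suc m)))
      where
      a : Color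
      a = offset B (suc k)
      left : LeavesIsolatedBy (Interval B a) (leftBranch B k)
      left = chain-isolated (All.map (avoids-mono proj₂) (colorRun-avoids a (suc m))) (comb-isolated B k)
      right : LeavesIsolatedBy (Interval a (a + suc m)) (rightBranch B k)
      right = chain-isolated (replicate⁺ _ (λ _ ())) (isolated a)

    comb-unused : ∀ B k {c} → ¬ Interval B (offset B (suc k)) c → colorCount c (comb B k) ≡ 0
    comb-unused B zero    c∉ = unused B (c∉ ∘ Interval-⊆ ≤-refl (+-monoʳ-≤ B (m≤m+n (suc m) 0)))
    comb-unused B (suc k) {c} c∉ = trans (comb-colorCount B k c) (cong₂ _+_ (cong₂ _+_ run≡0 comb≡0) copy≡0)
      where
      a : Color
      a = offset B (suc k)
      end≡ : a + suc m ≡ offset B (suc (suc k))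
      end≡ = offset-suc B (suc k)
      c∉block : ¬ Interval a (a + suc m) c
      c∉block = c∉ ∘ Interval-⊆ (m≤m+n B _) (≤-reflexive end≡)
      run≡0 : labelCount c (colorRun a (suc m)) ≡ 0
      run≡0 = labelCount-colorRun-outside a (suc m) c∉block
      comb≡0 : colorCount c (comb B k) ≡ 0
      comb≡0 = comb-unused B k (c∉ ∘ Interval-⊆ ≤-refl (≤-trans (m≤m+n a (suc m)) (≤-reflexive end≡)))
      copy≡0 : colorCount c (copy a) ≡ 0
      copy≡0 = unused a c∉block

    -- A color below the new block occurs only inside comb B k; a color of the
    -- block occurs once on the path and otherwise only inside the new copy.
    comb-colorBound : ∀ B k c → colorCount c (comb B k) ≤ suc colors
    comb-colorBound B zero    c = m≤n⇒m≤1+n (colorBound B c)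
    comb-colorBound B (suc k) c with c <? offset B (suc k)
    ... | yes c<a = begin
      colorCount c (comb B (suc k))                         ≡⟨ comb-colorCount B k c ⟩
      labelCount c (colorRun a (suc m)) + colorCount c (comb B k) + colorCount c (copy a)
        ≡⟨ cong₂ _+_ (cong (_+ colorCount c (comb B k)) (labelCount-colorRun-outside a (suc m) c∉block))
                     (unused a c∉block) ⟩
      colorCount c (comb B k) + 0                           ≡⟨ +-identityʳ _ ⟩
      colorCount c (comb B k)                               ≤⟨ comb-colorBound B k c ⟩
      suc colors                                            ∎
      where
      open ≤-Reasoning
      a : Color
      a = offset B (suc k)
      c∉block : ¬ Interval a (a + suc m) c
      c∉block (a≤c , _) = <⇒≱ c<a a≤c
    ... | no c≮a = begin
      colorCount c (comb B (suc k))                         ≡⟨ comb-colorCount B k c ⟩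
      labelCount c (colorRun a (suc m)) + colorCount c (comb B k) + colorCount c (copy a)
        ≡⟨ cong (λ n → labelCount c (colorRun a (suc m)) + n + colorCount c (copy a))
                (comb-unused B k (λ (_ , c<a) → c≮a c<a)) ⟩
      labelCount c (colorRun a (suc m)) + 0 + colorCount c (copy a)
        ≤⟨ +-mono-≤ (≤-trans (≤-reflexive (+-identityʳ _)) (labelCount-colorRun-≤1 c a (suc m))) (colorBound a c) ⟩
      suc colors                                            ∎
      where
      open ≤-Reasoning
      a : Color
      a = offset B (suc k)

    comb-leafTotal : ∀ B k → leafCount (comb B k) ≡ suc k * suc m
    comb-leafTotal B zero    = trans (leafTotal B) (sym (+-identityʳ (suc m)))
    comb-leafTotal B (suc k) = begin
      leafCount (comb B (suc k))
        ≡⟨ joinRoots-leafCount (leftBranch B k) (rightBranch B k) (λ ()) (λ ()) ⟩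
      leafCount (leftBranch B k) + leafCount (rightBranch B k)
        ≡⟨ cong₂ _+_ (chain-leafCount (colorRun a (suc m))) (chain-leafCount (replicate (2 * (suc k * suc m)) nothing)) ⟩
      leafCount (comb B k) + leafCount (copy a)             ≡⟨ cong₂ _+_ (comb-leafTotal B k) (leafTotal a) ⟩
      suc k * suc m + suc m                                 ≡⟨ +-comm (suc k * suc m) (suc m) ⟩
      suc (suc k) * suc m                                   ∎
      where
      open ≡-Reasoning
      a : Color
      a = offset B (suc k)

    comb-edgeTotal : ∀ B k → edgeCount (comb B k) ≡ suc k * edges + k * (k + 2) * suc m
    comb-edgeTotal B zero    = trans (edgeTotal B) (sym (trans (+-identityʳ _) (+-identityʳ edges)))
    comb-edgeTotal B (suc k) = begin
      edgeCount (comb B (suc k))                 ≡⟨ joinRoots-edgeCount (leftBranch B k) (rightBranch B k) ⟩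
      edgeCount (leftBranch B k) + edgeCount (rightBranch B k)
        ≡⟨ cong₂ _+_ (chain-edgeCount (colorRun a (suc m))) (chain-edgeCount (replicate r nothing)) ⟩
      length (colorRun a (suc m)) + edgeCount (comb B k) + (length (replicate r nothing) + edgeCount (copy a))
        ≡⟨ cong₂ _+_ (cong₂ _+_ (length-colorRun a (suc m)) (comb-edgeTotal B k))
                     (cong₂ _+_ (length-replicate r) (edgeTotal a)) ⟩
      suc m + (suc k * edges + k * (k + 2) * suc m) + (2 * (suc k * suc m) + edges)
        ≡⟨ count m k edges ⟩
      suc (suc k) * edges + suc k * (suc k + 2) * suc m ∎
      where
      open ≡-Reasoning
      a r : ℕ
      a = offset B (suc k)
      r = 2 * (suc k * suc m)
      count : ∀ m k e → suc m + (suc k * e + k * (k + 2) * suc m) + (2 * (suc k * suc m) + e) ≡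
                        suc (suc k) * e + suc k * (suc k + 2) * suc m
      count = solve-∀

    comb-family : ∀ k → IsolatingFamily (m + k * suc m) (suc colors) (suc k * edges + k * (k + 2) * suc m) (λ B → comb B k)
    comb-family k = record
      { depths     = λ B → comb-depths B k
      ; isolated   = λ B → comb-isolated B k
      ; unused     = λ B → comb-unused B k
      ; colorBound = λ B → comb-colorBound B k
      ; leafTotal  = λ B → comb-leafTotal B k
      ; edgeTotal  = λ B → comb-edgeTotal B k
      }

-- The construction for q = suc p; note that p * (p + 2) = q² - 1.
module Levels (p : ℕ) where

  minDepth : ℕ → ℕ
  minDepth zero    = 0
  minDepth (suc d) = minDepth d + p * suc (minDepth d)

  totalEdges : ℕ → ℕ
  totalEdges zero    = 0
  totalEdges (suc d) = suc p * totalEdges d + p * (p + 2) * suc (minDepth d)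

  tree : ℕ → Color → Tree
  tree zero    _ = node []
  tree (suc d) B = Comb.comb (minDepth d) (tree d) B p

  tree-family : ∀ d → IsolatingFamily (minDepth d) d (totalEdges d) (tree d)
  tree-family zero    = single-vertex-family
  tree-family (suc d) = Comb.comb-family (minDepth d) (tree d) (tree-family d) p

  suc-minDepth : ∀ d → suc (minDepth d) ≡ suc p ^ d
  suc-minDepth zero    = refl
  suc-minDepth (suc d) = cong (suc p *_) (suc-minDepth d)

  totalEdges-suc : ∀ d → totalEdges (suc d) ≡ suc d * (suc p ^ d * (p * (p + 2)))
  totalEdges-suc zero    = base p
    where
    base : ∀ p → suc p * 0 + p * (p + 2) * 1 ≡ 1 * (1 * (p * (p + 2)))
    base = solve-∀
  totalEdges-suc (suc d) = begin
    suc p * totalEdges (suc d) + p * (p + 2) * suc (minDepth (suc d))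
      ≡⟨ cong₂ (λ e s → suc p * e + p * (p + 2) * s) (totalEdges-suc d) (suc-minDepth (suc d)) ⟩
    suc p * (suc d * (suc p ^ d * (p * (p + 2)))) + p * (p + 2) * (suc p * suc p ^ d)
      ≡⟨ step p d (suc p ^ d) ⟩
    suc (suc d) * (suc p * suc p ^ d * (p * (p + 2))) ∎
    where
    open ≡-Reasoning
    step : ∀ p d x → suc p * (suc d * (x * (p * (p + 2)))) + p * (p + 2) * (suc p * x) ≡
                     suc (suc d) * (suc p * x * (p * (p + 2)))
    step = solve-∀

  totalEdges-closed : ∀ d → totalEdges d ≡ d * (suc p ^ (d + 1) ∸ suc p ^ (d ∸ 1))
  totalEdges-closed zero    = refl
  totalEdges-closed (suc d) = trans (totalEdges-suc d) (cong (suc d *_) (sym growth))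
    where
    square : ∀ p x → suc p * (suc p * x) ≡ x + x * (p * (p + 2))
    square = solve-∀
    growth : suc p ^ (suc d + 1) ∸ suc p ^ d ≡ suc p ^ d * (p * (p + 2))
    growth = begin
      suc p ^ (suc d + 1) ∸ suc p ^ d                       ≡⟨ cong (λ n → suc p ^ suc n ∸ suc p ^ d) (+-comm d 1) ⟩
      suc p * (suc p * suc p ^ d) ∸ suc p ^ d               ≡⟨ cong (_∸ suc p ^ d) (square p (suc p ^ d)) ⟩
      suc p ^ d + suc p ^ d * (p * (p + 2)) ∸ suc p ^ d     ≡⟨ m+n∸m≡n (suc p ^ d) _ ⟩
      suc p ^ d * (p * (p + 2))                             ∎
      where open ≡-Reasoning

lemma3p6 : (Δ q : ℕ) → 2 ≤ q →
  Σ Tree (λ T →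
    ((v : Vertex T) → IsLeaf v →
      Σ Color (λ c →
        ConnectedAvoiding c v ×
        ((w : Vertex T) → IsLeaf w → ConnectedAvoiding c w → w ≢ v →
          depth v < depth w)))
    × ((c : Color) → colorCount c T ≤ Δ)
    × leafCount T ≡ q ^ Δ
    × ((v : Vertex T) → IsLeaf v →
        (q ^ Δ ∸ 1 ≤ depth v) × (depth v ≤ 2 * (q ^ Δ ∸ 1)))
    × edgeCount T ≡ Δ * (q ^ (Δ + 1) ∸ q ^ (Δ ∸ 1)))
lemma3p6 Δ zero    ()
lemma3p6 Δ (suc p) _ =
    tree Δ 0
  , (λ v leaf → map₂ proj₂ (isolated 0 v leaf))
  , colorBound 0
  , trans (leafTotal 0) (suc-minDepth Δ)
  , subst (λ n → LeafDepthsIn (tree Δ 0) n (2 * n)) (cong (_∸ 1) (suc-minDepth Δ)) (depths 0)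
  , trans (edgeTotal 0) (totalEdges-closed Δ)
  where
  open Levels p
  open IsolatingFamily (tree-family Δ)
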